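{- The sensitivity of the complete regular multipartite graph with $m$ parts of order $n$ is $\sigma(K_n^m)=\sigma(\overline{K}_n \vee \cdots \vee \overline{K}_n) = \left\lceil \frac{n+1}{2} \right\rceil$. The family $\{K_n^m\}_{n=1}^\infty$ is sensitive and the family $\{K_n^m\}_{m=1}^\infty$ is insensitive with a constant sensitivity that can be made arbitrarily large by fixing a sufficiently large number of vertices in each part.
   Context: All graphs are finite, undirected and simple. $\overline{K}_n$ denotes the empty (edgeless) graph on $n$ vertices and $\vee$ the join (disjoint union plus all edges between graphs); $K_n^m=\overline{K}_n\vee\cdots\vee\overline{K}_n$ ($m$ copies) is the complete regular multipartite graph with $m$ parts of order $n$. $\alpha(G)$ is the independence number and $\Delta(G)$ the maximum degree. The sensitivity of a nonempty graph $G=(V,E)$ is $\sigma(G)=\min\{\Delta(G[S]) : S\subseteq V,\ |S|>\alpha(G)\}$. An indexed family of graphs $G_n$ with $\Delta(G_n)\to\infty$ is sensitive if $\sigma(G_n)\to\infty$ and insensitive otherwise. -}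

module Defs where

open import Data.Bool using (Bool; true; false; not; if_then_else_)
open import Data.Nat using (ℕ; zero; suc; _+_; _*_; _≤_; _<_; _⊔_)
open import Data.Fin using (Fin; quotient) renaming (_≟_ to _≟ᶠ_)
open import Data.Fin.Subset using (Subset; Side; inside; outside; _∈_; _∩_; ∣_∣; ⊤)
open import Data.Vec using (tabulate; lookup)
open import Data.List using (foldr; map; allFin)
open import Data.Product using (Σ; ∃; _×_)
open import Relation.Nullary.Decidable using (⌊_⌋)
open import Relation.Binary.PropositionalEquality using (_≡_)

record Graph (V : ℕ) : Set where
  field
    adj   : Fin V → Fin V → Bool
    sym   : ∀ u v → adj u v ≡ adj v u
    irref : ∀ v → adj v v ≡ false
open Graph public

nbhd : ∀ {V} → Graph V → Fin V → Subset V
nbhd G v = tabulate (λ u → if adj G v u then inside else outside)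

degIn : ∀ {V} → Graph V → Subset V → Fin V → ℕ
degIn G S v = ∣ S ∩ nbhd G v ∣

isIn : Side → Bool
isIn inside  = true
isIn outside = false

-- Δ(G[S]) : maximum degree of the induced subgraph G[S] (0 if S is empty)
maxDegIn : ∀ {V} → Graph V → Subset V → ℕ
maxDegIn {V} G S =
  foldr _⊔_ 0 (map (λ v → if isIn (lookup S v) then degIn G S v else 0) (allFin V))

maxDeg : ∀ {V} → Graph V → ℕ
maxDeg G = maxDegIn G ⊤

Independent : ∀ {V} → Graph V → Subset V → Set
Independent G S = ∀ u v → u ∈ S → v ∈ S → adj G u v ≡ false

IsIndependenceNumber : ∀ {V} → Graph V → ℕ → Set
IsIndependenceNumber G a =
  (∃ λ S → Independent G S × ∣ S ∣ ≡ a) ×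
  (∀ S → Independent G S → ∣ S ∣ ≤ a)

-- k is the sensitivity σ(G) = min { Δ(G[S]) : |S| > α(G) }
IsSensitivity : ∀ {V} → Graph V → ℕ → Set
IsSensitivity G k =
  ∀ a → IsIndependenceNumber G a →
    (∃ λ S → a < ∣ S ∣ × maxDegIn G S ≡ k) ×
    (∀ S → a < ∣ S ∣ → k ≤ maxDegIn G S)

-- The complete regular multipartite graph K_n^m : m parts of order n.
-- Vertex i : Fin (m * n) lies in part  quotient n i : Fin m;
-- two vertices are adjacent iff they lie in different parts.
partAdj : ∀ m n → Fin (m * n) → Fin (m * n) → Bool
partAdj m n i j = not ⌊ quotient {m} n i ≟ᶠ quotient {m} n j ⌋

private
  open import Data.Empty using (⊥-elim)
  open import Relation.Nullary using (yes; no)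
  open import Relation.Binary.PropositionalEquality using (refl) renaming (sym to ≡-sym)

  eqb-sym : ∀ {k} (x y : Fin k) → ⌊ x ≟ᶠ y ⌋ ≡ ⌊ y ≟ᶠ x ⌋
  eqb-sym x y with x ≟ᶠ y | y ≟ᶠ x
  ... | yes _ | yes _ = refl
  ... | no _  | no _  = refl
  ... | yes p | no q  = ⊥-elim (q (≡-sym p))
  ... | no p  | yes q = ⊥-elim (p (≡-sym q))

  eqb-refl : ∀ {k} (x : Fin k) → ⌊ x ≟ᶠ x ⌋ ≡ true
  eqb-refl x with x ≟ᶠ x
  ... | yes _ = refl
  ... | no p  = ⊥-elim (p refl)

  open import Relation.Binary.PropositionalEquality using (cong)

K : ∀ n m → Graph (m * n)
K n m = record
  { adj   = partAdj m n
  ; sym   = λ u v → cong not (eqb-sym (quotient {m} n u) (quotient {m} n v))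
  ; irref = λ v → cong not (eqb-refl (quotient {m} n v))
  }

open import Relation.Nullary using (¬_)

Diverges : (ℕ → ℕ) → Set
Diverges f = ∀ B → ∃ λ N → ∀ i → N ≤ i → B ≤ f i

-- σ(G_i) → ∞  (σ(G_i) being the unique k with IsSensitivity (G i) k)
SensitivityDiverges : {V : ℕ → ℕ} → ((i : ℕ) → Graph (V i)) → Set
SensitivityDiverges G =
  ∀ B → ∃ λ N → ∀ i → N ≤ i → ∀ k → IsSensitivity (G i) k → B ≤ k

SensitiveFamily : {V : ℕ → ℕ} → ((i : ℕ) → Graph (V i)) → Set
SensitiveFamily G = Diverges (λ i → maxDeg (G i)) × SensitivityDiverges G

InsensitiveFamily : {V : ℕ → ℕ} → ((i : ℕ) → Graph (V i)) → Set
InsensitiveFamily G = Diverges (λ i → maxDeg (G i)) × ¬ SensitivityDiverges G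

module Submission where

-- The parts of K_n^m are its maximum independent sets, so α = n. Let |S| > n and pick
-- u ∈ S; put A = |S ∩ part(u)| ≤ n and B = |S ∖ part(u)| = deg_S u, so B ≥ 1. Any
-- w ∈ S outside part(u) is adjacent to all of S ∩ part(u), hence
-- Δ(G[S]) ≥ max(A, B) ≥ ⌈(A + B)/2⌉ ≥ ⌈(n + 1)/2⌉. Taking ⌈(n + 1)/2⌉ vertices of one
-- part and ⌊(n + 1)/2⌋ of another attains the bound. As Δ(K_n^m) = (m − 1)n, the
-- statements about the two families follow from this exact value.

open import Defs hiding (sym)
open import Data.Bool using (Bool; true; false; not; _∧_; if_then_else_; T)
open import Data.Bool.Properties using (∧-identityʳ; ∧-zeroʳ; ∧-conicalˡ; ∧-conicalʳ; not-injective)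
open import Data.Fin using (Fin; zero; suc; toℕ; quotient; remainder; remQuot; _↑ˡ_; _↑ʳ_) renaming (_≟_ to _≟ᶠ_)
open import Data.Fin.Properties using (splitAt-↑ʳ; remQuot-combine)
open import Data.Fin.Subset using (Subset; ∣_∣; ⊤; _∩_; _∈_)
open import Data.Fin.Subset.Properties using (∣⊤∣≡n)
open import Data.List using (List; []; _∷_; foldr; map; allFin)
open import Data.List.Membership.Propositional using () renaming (_∈_ to _∈ˡ_)
open import Data.List.Membership.Propositional.Properties using (∈-allFin)
open import Data.List.Relation.Unary.Any using (here; there)
open import Data.Nat using (ℕ; zero; suc; _+_; _*_; _≤_; _<_; _⊔_; z≤n; s≤s; _<ᵇ_; _<?_; ⌈_/2⌉; ⌊_/2⌋)
open import Data.Nat.Properties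
open import Algebra.Properties.CommutativeSemigroup +-commutativeSemigroup using (interchange)
open import Data.Product using (∃; _×_; _,_; proj₁; proj₂)
open import Data.Unit using (tt)
open import Data.Vec using ([]; _∷_; lookup; tabulate)
open import Data.Vec.Properties using (lookup∘tabulate; lookup-zipWith; lookup-replicate; []=⇒lookup; lookup⇒[]=)
open import Function using (_∘_)
open import Relation.Nullary using (¬_; yes; no)
open import Relation.Nullary.Decidable using (⌊_⌋; ⌊⌋-map′; toWitness; isYes≗does; dec-true; dec-false)
open import Relation.Binary.PropositionalEquality

count : ∀ {V} → (Fin V → Bool) → ℕ
count {zero}  f = 0
count {suc V} f = (if f zero then 1 else 0) + count (f ∘ suc)

∣S∣≡count : ∀ {V} (S : Subset V) → ∣ S ∣ ≡ count (lookup S)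
∣S∣≡count []          = refl
∣S∣≡count (true ∷ S)  = cong suc (∣S∣≡count S)
∣S∣≡count (false ∷ S) = ∣S∣≡count S

∣tabulate∣≡count : ∀ {V} (f : Fin V → Bool) → ∣ tabulate f ∣ ≡ count f
∣tabulate∣≡count {zero}  f = refl
∣tabulate∣≡count {suc V} f with f zero
... | true  = cong suc (∣tabulate∣≡count (f ∘ suc))
... | false = ∣tabulate∣≡count (f ∘ suc)

count-cong : ∀ {V} {f g : Fin V → Bool} → (∀ i → f i ≡ g i) → count f ≡ count g
count-cong {zero}  f≗g = refl
count-cong {suc V} f≗g = cong₂ _+_ (cong (λ b → if b then 1 else 0) (f≗g zero)) (count-cong (f≗g ∘ suc))

count-mono : ∀ {V} {f g : Fin V → Bool} → (∀ i → f i ≡ true → g i ≡ true) → count f ≤ count g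
count-mono {zero}          f⇒g = z≤n
count-mono {suc V} {f} {g} f⇒g = +-mono-≤ (head (f zero) (g zero) (f⇒g zero)) (count-mono (f⇒g ∘ suc))
  where
  head : ∀ a b → (a ≡ true → b ≡ true) → (if a then 1 else 0) ≤ (if b then 1 else 0)
  head false b _                      = z≤n
  head true  b a⇒b rewrite a⇒b refl = ≤-refl

count-false : ∀ V → count {V} (λ _ → false) ≡ 0
count-false zero    = refl
count-false (suc V) = count-false V

count-true : ∀ V → count {V} (λ _ → true) ≡ V
count-true zero    = refl
count-true (suc V) = cong suc (count-true V)

count-split : ∀ {V} (f g : Fin V → Bool) →
              count f ≡ count (λ i → f i ∧ g i) + count (λ i → f i ∧ not (g i))
count-split {zero}  f g = refl
count-split {suc V} f g = begin
  (if f zero then 1 else 0) + count (f ∘ suc)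
    ≡⟨ cong₂ _+_ (head (f zero) (g zero)) (count-split (f ∘ suc) (g ∘ suc)) ⟩
  (x + y) + (count (λ i → f (suc i) ∧ g (suc i)) + count (λ i → f (suc i) ∧ not (g (suc i))))
    ≡⟨ interchange x y _ _ ⟩
  (x + count (λ i → f (suc i) ∧ g (suc i))) + (y + count (λ i → f (suc i) ∧ not (g (suc i)))) ∎
  where
  open ≡-Reasoning
  x y : ℕ
  x = if f zero ∧ g zero then 1 else 0
  y = if f zero ∧ not (g zero) then 1 else 0
  head : ∀ a b → (if a then 1 else 0) ≡ (if a ∧ b then 1 else 0) + (if a ∧ not b then 1 else 0)
  head false b     = refl
  head true  true  = refl
  head true  false = refl

0<count⇒∃ : ∀ {V} (f : Fin V → Bool) → 0 < count f → ∃ λ i → f i ≡ true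
0<count⇒∃ {suc V} f 0<count with f zero in f0
... | true  = zero , f0
... | false = let i , fi = 0<count⇒∃ (f ∘ suc) 0<count in suc i , fi

count-↑ : ∀ m n (f : Fin (m + n) → Bool) →
          count f ≡ count (λ i → f (i ↑ˡ n)) + count (λ j → f (m ↑ʳ j))
count-↑ zero    n f = refl
count-↑ (suc m) n f = trans (cong ((if f zero then 1 else 0) +_) (count-↑ m n (f ∘ suc)))
                            (sym (+-assoc (if f zero then 1 else 0) _ _))

count-<ᵇ : ∀ n a → a ≤ n → count {n} (λ j → toℕ j <ᵇ a) ≡ a
count-<ᵇ n       zero    _         = count-false n
count-<ᵇ (suc n) (suc a) (s≤s a≤n) = cong suc (count-<ᵇ n a a≤n)

_==_ : ∀ {k} → Fin k → Fin k → Bool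
x == y = ⌊ x ≟ᶠ y ⌋

==⇒≡ : ∀ {k} {x y : Fin k} → (x == y) ≡ true → x ≡ y
==⇒≡ x==y = toWitness (subst T (sym x==y) tt)

==-refl : ∀ {k} (x : Fin k) → (x == x) ≡ true
==-refl x = trans (isYes≗does (x ≟ᶠ x)) (dec-true (x ≟ᶠ x) refl)

==-suc : ∀ {k} (x y : Fin k) → (suc x == suc y) ≡ (x == y)
==-suc x y = ⌊⌋-map′ _ _ (x ≟ᶠ y)

==false⇒≢ : ∀ {k} {x y : Fin k} → (x == y) ≡ false → ¬ x ≡ y
==false⇒≢ {x = x} x==y refl with trans (sym x==y) (==-refl x)
... | ()

≢⇒==false : ∀ {k} {x y : Fin k} → ¬ x ≡ y → (x == y) ≡ false
≢⇒==false {x = x} {y} x≢y = trans (isYes≗does (x ≟ᶠ y)) (dec-false (x ≟ᶠ y) x≢y)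

remQuot-↑ʳ : ∀ m n (i : Fin (m * n)) →
             remQuot {suc m} n (n ↑ʳ i) ≡ (suc (quotient {m} n i) , remainder {m} n i)
remQuot-↑ʳ m n i rewrite splitAt-↑ʳ n (m * n) i = refl

count-block : ∀ m n (p : Fin m) (g : Fin n → Bool) →
              count (λ i → g (remainder {m} n i) ∧ (p == quotient {m} n i)) ≡ count g
count-block (suc m) n p g = begin
  count (λ i → inBlock (remQuot {suc m} n i))
    ≡⟨ count-↑ n (m * n) _ ⟩
  count (λ j → inBlock (remQuot {suc m} n (j ↑ˡ m * n))) + count (λ i → inBlock (remQuot {suc m} n (n ↑ʳ i)))
    ≡⟨ cong₂ _+_ (count-cong (cong inBlock ∘ remQuot-combine zero))
                 (count-cong (cong inBlock ∘ remQuot-↑ʳ m n)) ⟩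
  count (λ j → g j ∧ (p == zero)) + count (λ i → g (remainder {m} n i) ∧ (p == suc (quotient {m} n i)))
    ≡⟨ firstBlockOrLater p ⟩
  count g ∎
  where
  open ≡-Reasoning
  inBlock : Fin (suc m) × Fin n → Bool
  inBlock (x , j) = g j ∧ (p == x)
  firstBlockOrLater : ∀ (p : Fin (suc m)) →
    count (λ j → g j ∧ (p == zero)) + count (λ i → g (remainder {m} n i) ∧ (p == suc (quotient {m} n i)))
      ≡ count g
  firstBlockOrLater zero = begin
    count (λ j → g j ∧ true) + count (λ i → g (remainder {m} n i) ∧ false)
      ≡⟨ cong₂ _+_ (count-cong (∧-identityʳ ∘ g))
                   (trans (count-cong (∧-zeroʳ ∘ g ∘ remainder {m} n)) (count-false (m * n))) ⟩
    count g + 0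
      ≡⟨ +-identityʳ (count g) ⟩
    count g ∎
  firstBlockOrLater (suc p) = begin
    count (λ j → g j ∧ false) + count (λ i → g (remainder {m} n i) ∧ (suc p == suc (quotient {m} n i)))
      ≡⟨ cong₂ _+_ (trans (count-cong (∧-zeroʳ ∘ g)) (count-false n))
                   (count-cong (λ i → cong (g (remainder {m} n i) ∧_) (==-suc p (quotient {m} n i)))) ⟩
    count (λ i → g (remainder {m} n i) ∧ (p == quotient {m} n i))
      ≡⟨ count-block m n p g ⟩
    count g ∎

if-true-false : ∀ b → (if b then true else false) ≡ b
if-true-false true  = refl
if-true-false false = refl

degIn≡count : ∀ {V} (G : Graph V) S v → degIn G S v ≡ count (λ w → lookup S w ∧ adj G v w)
degIn≡count G S v = trans (∣S∣≡count (S ∩ nbhd G v)) (count-cong λ w →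
  trans (lookup-zipWith _∧_ w S (nbhd G v))
        (cong (lookup S w ∧_) (trans (lookup∘tabulate _ w) (if-true-false (adj G v w)))))

foldr-⊔-lub : ∀ {A : Set} (f : A → ℕ) k (xs : List A) → (∀ x → f x ≤ k) → foldr _⊔_ 0 (map f xs) ≤ k
foldr-⊔-lub f k []       f≤k = z≤n
foldr-⊔-lub f k (x ∷ xs) f≤k = ⊔-lub (f≤k x) (foldr-⊔-lub f k xs f≤k)

foldr-⊔-ub : ∀ {A : Set} (f : A → ℕ) {x} (xs : List A) → x ∈ˡ xs → f x ≤ foldr _⊔_ 0 (map f xs)
foldr-⊔-ub f (y ∷ xs) (here refl)  = m≤m⊔n (f y) _
foldr-⊔-ub f (y ∷ xs) (there x∈xs) = m≤n⇒m≤o⊔n (f y) (foldr-⊔-ub f xs x∈xs)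

module _ {V} (G : Graph V) (S : Subset V) where

  private
    degIfIn : Fin V → ℕ
    degIfIn v = if isIn (lookup S v) then degIn G S v else 0

  maxDegIn-lub : ∀ k → (∀ v → lookup S v ≡ true → degIn G S v ≤ k) → maxDegIn G S ≤ k
  maxDegIn-lub k deg≤k = foldr-⊔-lub degIfIn k (allFin V) bound
    where
    bound : ∀ v → degIfIn v ≤ k
    bound v with lookup S v in v∈S
    ... | true  = deg≤k v v∈S
    ... | false = z≤n

  degIn≤maxDegIn : ∀ v → lookup S v ≡ true → degIn G S v ≤ maxDegIn G S
  degIn≤maxDegIn v v∈S = subst (_≤ maxDegIn G S) (cong (λ b → if isIn b then degIn G S v else 0) v∈S)
    (foldr-⊔-ub degIfIn (allFin V) (∈-allFin v))

module _ {V} (G : Graph V) where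

  independenceNumber-unique : ∀ {a b} → IsIndependenceNumber G a → IsIndependenceNumber G b → a ≡ b
  independenceNumber-unique ((S , indS , refl) , maxA) ((T , indT , refl) , maxB) =
    ≤-antisym (maxB S indS) (maxA T indT)

  isSensitivity : ∀ {a k} → IsIndependenceNumber G a →
                  (∃ λ S → a < ∣ S ∣ × maxDegIn G S ≡ k) → (∀ S → a < ∣ S ∣ → k ≤ maxDegIn G S) →
                  IsSensitivity G k
  isSensitivity α attained minimal b αb rewrite independenceNumber-unique αb α = attained , minimal

  sensitivity-unique : ∀ {a k l} → IsIndependenceNumber G a → IsSensitivity G k → IsSensitivity G l → k ≡ l
  sensitivity-unique {a} α σk σl with σk a α | σl a α
  ... | (S , a<∣S∣ , refl) , minK | (T , a<∣T∣ , refl) , minL = ≤-antisym (minK T a<∣T∣) (minL S a<∣S∣)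

⌈m+n/2⌉≤m⊔n : ∀ a b → ⌈ a + b /2⌉ ≤ a ⊔ b
⌈m+n/2⌉≤m⊔n a b = begin
  ⌈ a + b /2⌉             ≤⟨ ⌈n/2⌉-mono (+-mono-≤ (m≤m⊔n a b) (m≤n⊔m a b)) ⟩
  ⌈ (a ⊔ b) + (a ⊔ b) /2⌉ ≡⟨ n≡⌈n+n/2⌉ (a ⊔ b) ⟨
  a ⊔ b                   ∎
  where open ≤-Reasoning

m+m≤n⇒m≤⌈n/2⌉ : ∀ {a x} → a + a ≤ x → a ≤ ⌈ x /2⌉
m+m≤n⇒m≤⌈n/2⌉ {a} a+a≤x = ≤-trans (≤-reflexive (n≡⌈n+n/2⌉ a)) (⌈n/2⌉-mono a+a≤x)

module Multipartite (n m : ℕ) where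

  private
    G : Graph (m * n)
    G = K n m
    q : Fin (m * n) → Fin m
    q = quotient {m} n
    r : Fin (m * n) → Fin n
    r = remainder {m} n

  -- adj G v w is, definitionally, not (part (q v) w).
  part : Fin m → Fin (m * n) → Bool
  part p i = p == q i

  count-part : ∀ p → count (part p) ≡ n
  count-part p = trans (count-block m n p (λ _ → true)) (count-true n)

  count-part-<ᵇ : ∀ p a → a ≤ n → count (λ i → (toℕ (r i) <ᵇ a) ∧ part p i) ≡ a
  count-part-<ᵇ p a a≤n = trans (count-block m n p (λ j → toℕ j <ᵇ a)) (count-<ᵇ n a a≤n)

  count-∧-part≤n : ∀ (f : Fin (m * n) → Bool) p → count (λ i → f i ∧ part p i) ≤ n
  count-∧-part≤n f p = ≤-trans (count-mono (λ i → ∧-conicalʳ (f i) _)) (≤-reflexive (count-part p))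

  ∧-part-quotient : ∀ (g : Fin m → Bool) p i → g (q i) ∧ part p i ≡ g p ∧ part p i
  ∧-part-quotient g p i with part p i in i∈p
  ... | true  = cong (λ x → g x ∧ true) (sym (==⇒≡ i∈p))
  ... | false = trans (∧-zeroʳ (g (q i))) (sym (∧-zeroʳ (g p)))

  degIn+inPart≡∣S∣ : ∀ S v → degIn G S v + count (λ w → lookup S w ∧ part (q v) w) ≡ ∣ S ∣
  degIn+inPart≡∣S∣ S v = begin
    degIn G S v + inPart   ≡⟨ cong (_+ inPart) (degIn≡count G S v) ⟩
    outPart + inPart       ≡⟨ +-comm outPart inPart ⟩
    inPart + outPart       ≡⟨ count-split (lookup S) (part (q v)) ⟨
    count (lookup S)       ≡⟨ ∣S∣≡count S ⟨
    ∣ S ∣                  ∎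
    where
    open ≡-Reasoning
    inPart outPart : ℕ
    inPart  = count (λ w → lookup S w ∧ part (q v) w)
    outPart = count (λ w → lookup S w ∧ not (part (q v) w))

  degIn-⊤+n≡m*n : ∀ v → degIn G ⊤ v + n ≡ m * n
  degIn-⊤+n≡m*n v = begin
    degIn G ⊤ v + n
      ≡⟨ cong (degIn G ⊤ v +_) (trans (sym (count-part (q v))) (count-cong ⊤∧part)) ⟩
    degIn G ⊤ v + count (λ w → lookup ⊤ w ∧ part (q v) w)
      ≡⟨ degIn+inPart≡∣S∣ ⊤ v ⟩
    ∣ ⊤ {m * n} ∣
      ≡⟨ ∣⊤∣≡n (m * n) ⟩
    m * n ∎
    where
    open ≡-Reasoning
    ⊤∧part : ∀ w → part (q v) w ≡ lookup ⊤ w ∧ part (q v) w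
    ⊤∧part w = cong (_∧ part (q v) w) (sym (lookup-replicate w true))

  independent⇒samePart : ∀ {S} → Independent G S →
                         ∀ u w → lookup S u ≡ true → lookup S w ≡ true → part (q u) w ≡ true
  independent⇒samePart {S} ind u w u∈S w∈S =
    not-injective (ind u w (lookup⇒[]= u S u∈S) (lookup⇒[]= w S w∈S))

  independent⇒∣S∣≤n : ∀ S → Independent G S → ∣ S ∣ ≤ n
  independent⇒∣S∣≤n S ind with 0 <? ∣ S ∣
  ... | no  ¬0<∣S∣ = ≤-trans (≮⇒≥ ¬0<∣S∣) z≤n
  ... | yes 0<∣S∣ with 0<count⇒∃ (lookup S) (subst (0 <_) (∣S∣≡count S) 0<∣S∣)
  ... | u , u∈S = begin
    ∣ S ∣              ≡⟨ ∣S∣≡count S ⟩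
    count (lookup S)   ≤⟨ count-mono (λ w → independent⇒samePart ind u w u∈S) ⟩
    count (part (q u)) ≡⟨ count-part (q u) ⟩
    n                  ∎
    where open ≤-Reasoning

  part-independent : ∀ p → Independent G (tabulate (part p))
  part-independent p u w u∈P w∈P =
    cong not (trans (cong₂ _==_ (inPart u∈P) (inPart w∈P)) (==-refl p))
    where
    inPart : ∀ {v} → v ∈ tabulate (part p) → q v ≡ p
    inPart {v} v∈P = sym (==⇒≡ (trans (sym (lookup∘tabulate (part p) v)) ([]=⇒lookup v∈P)))

  independenceNumber-K : Fin m → IsIndependenceNumber G n
  independenceNumber-K p =
    (tabulate (part p) , part-independent p , trans (∣tabulate∣≡count (part p)) (count-part p))
    , independent⇒∣S∣≤n

  inPart≤degIn : ∀ S p w → part p w ≡ false → count (λ x → lookup S x ∧ part p x) ≤ degIn G S w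
  inPart≤degIn S p w w∉p = subst (_ ≤_) (sym (degIn≡count G S w)) (count-mono adjacent)
    where
    adjacent : ∀ x → lookup S x ∧ part p x ≡ true → lookup S x ∧ not (part (q w) x) ≡ true
    adjacent x x∈S∩p
      rewrite ∧-conicalˡ (lookup S x) _ x∈S∩p | sym (==⇒≡ (∧-conicalʳ (lookup S x) _ x∈S∩p))
      = cong not (≢⇒==false (λ qw≡p → ==false⇒≢ w∉p (sym qw≡p)))

  ⌈suc-n/2⌉≤maxDegIn : ∀ S → n < ∣ S ∣ → ⌈ suc n /2⌉ ≤ maxDegIn G S
  ⌈suc-n/2⌉≤maxDegIn S n<∣S∣ = begin
    ⌈ suc n /2⌉   ≤⟨ ⌈n/2⌉-mono n<A+B ⟩
    ⌈ A + B /2⌉   ≤⟨ ⌈m+n/2⌉≤m⊔n A B ⟩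
    A ⊔ B         ≤⟨ ⊔-lub (≤-trans (inPart≤degIn S (q u) w w∉part) (degIn≤maxDegIn G S w w∈S))
                           (degIn≤maxDegIn G S u u∈S) ⟩
    maxDegIn G S  ∎
    where
    open ≤-Reasoning
    vertexIn : ∃ λ u → lookup S u ≡ true
    vertexIn = 0<count⇒∃ (lookup S) (subst (0 <_) (∣S∣≡count S) (m<n⇒0<n n<∣S∣))
    u : Fin (m * n)
    u = proj₁ vertexIn
    u∈S : lookup S u ≡ true
    u∈S = proj₂ vertexIn
    A B : ℕ
    A = count (λ x → lookup S x ∧ part (q u) x)
    B = degIn G S u
    n<A+B : n < A + B
    n<A+B = subst (n <_) (sym (trans (+-comm A B) (degIn+inPart≡∣S∣ S u))) n<∣S∣
    0<B : 0 < B
    0<B = +-cancelˡ-< A 0 B (begin-strict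
      A + 0 ≡⟨ +-identityʳ A ⟩
      A     ≤⟨ count-∧-part≤n (lookup S) (q u) ⟩
      n     <⟨ n<A+B ⟩
      A + B ∎)
    vertexOutside : ∃ λ w → lookup S w ∧ not (part (q u) w) ≡ true
    vertexOutside = 0<count⇒∃ (λ x → lookup S x ∧ not (part (q u) x)) (subst (0 <_) (degIn≡count G S u) 0<B)
    w : Fin (m * n)
    w = proj₁ vertexOutside
    w∈S : lookup S w ≡ true
    w∈S = ∧-conicalˡ (lookup S w) _ (proj₂ vertexOutside)
    w∉part : part (q u) w ≡ false
    w∉part = not-injective (∧-conicalʳ (lookup S w) _ (proj₂ vertexOutside))

m*n≤maxDeg-K : ∀ n m → m * suc n ≤ maxDeg (K (suc n) (suc m))
m*n≤maxDeg-K n m =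
  subst (_≤ maxDeg (K (suc n) (suc m))) deg0≡ (degIn≤maxDegIn (K (suc n) (suc m)) ⊤ zero refl)
  where
  open Multipartite (suc n) (suc m)
  deg0≡ : degIn (K (suc n) (suc m)) ⊤ zero ≡ m * suc n
  deg0≡ = +-cancelʳ-≡ (suc n) _ _ (trans (degIn-⊤+n≡m*n zero) (+-comm (suc n) (m * suc n)))

module Balanced (n m : ℕ) where

  open Multipartite (suc n) (suc (suc m))

  private
    G : Graph (suc (suc m) * suc n)
    G = K (suc n) (suc (suc m))
    q : Fin (suc (suc m) * suc n) → Fin (suc (suc m))
    q = quotient {suc (suc m)} (suc n)
    r : Fin (suc (suc m) * suc n) → Fin (suc n)
    r = remainder {suc (suc m)} (suc n)
    k h : ℕ
    k = ⌈ suc (suc n) /2⌉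
    h = ⌊ suc (suc n) /2⌋

  quota : Fin (suc (suc m)) → ℕ
  quota zero          = k
  quota (suc zero)    = h
  quota (suc (suc _)) = 0

  quota≤n : ∀ p → quota p ≤ suc n
  quota≤n zero          = ≤-pred (⌈n/2⌉<n n)
  quota≤n (suc zero)    = ≤-pred (⌊n/2⌋<n (suc n))
  quota≤n (suc (suc _)) = z≤n

  h≤quota : ∀ p → 0 < quota p → h ≤ quota p
  h≤quota zero       _ = ⌊n/2⌋≤⌈n/2⌉ (suc (suc n))
  h≤quota (suc zero) _ = ≤-refl

  inQuota : Fin (suc (suc m) * suc n) → Bool
  inQuota i = toℕ (r i) <ᵇ quota (q i)

  balanced : Subset (suc (suc m) * suc n)
  balanced = tabulate inQuota

  count-inQuota-part : ∀ p → count (λ i → inQuota i ∧ part p i) ≡ quota p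
  count-inQuota-part p = begin
    count (λ i → inQuota i ∧ part p i)
      ≡⟨ count-cong (λ i → ∧-part-quotient (λ x → toℕ (r i) <ᵇ quota x) p i) ⟩
    count (λ i → (toℕ (r i) <ᵇ quota p) ∧ part p i)
      ≡⟨ count-part-<ᵇ p (quota p) (quota≤n p) ⟩
    quota p ∎
    where open ≡-Reasoning

  ∣balanced∣ : ∣ balanced ∣ ≡ k + h
  ∣balanced∣ = begin
    ∣ balanced ∣
      ≡⟨ ∣tabulate∣≡count inQuota ⟩
    count inQuota
      ≡⟨ count-split inQuota (part zero) ⟩
    count (λ i → inQuota i ∧ part zero i) + count (λ i → inQuota i ∧ not (part zero i))
      ≡⟨ cong (count (λ i → inQuota i ∧ part zero i) +_)
              (count-cong (λ i → outsidePart0 (toℕ (r i)) (q i))) ⟩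
    count (λ i → inQuota i ∧ part zero i) + count (λ i → inQuota i ∧ part (suc zero) i)
      ≡⟨ cong₂ _+_ (count-inQuota-part zero) (count-inQuota-part (suc zero)) ⟩
    k + h ∎
    where
    open ≡-Reasoning
    outsidePart0 : ∀ t x → (t <ᵇ quota x) ∧ not (zero == x) ≡ (t <ᵇ quota x) ∧ (suc zero == x)
    outsidePart0 t zero          = refl
    outsidePart0 t (suc zero)    = cong ((t <ᵇ h) ∧_) (sym (==-refl (suc (zero {suc m}))))
    outsidePart0 t (suc (suc x)) = refl

  count-balanced-part : ∀ p → count (λ i → lookup balanced i ∧ part p i) ≡ quota p
  count-balanced-part p =
    trans (count-cong (λ i → cong (_∧ part p i) (lookup∘tabulate inQuota i))) (count-inQuota-part p)

  degIn-balanced≤k : ∀ v → lookup balanced v ≡ true → degIn G balanced v ≤ k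
  degIn-balanced≤k v v∈B = +-cancelʳ-≤ h (degIn G balanced v) k (begin
    degIn G balanced v + h
      ≤⟨ +-monoʳ-≤ (degIn G balanced v) (h≤quota (q v) 0<quota) ⟩
    degIn G balanced v + quota (q v)
      ≡⟨ cong (degIn G balanced v +_) (count-balanced-part (q v)) ⟨
    degIn G balanced v + count (λ w → lookup balanced w ∧ part (q v) w)
      ≡⟨ degIn+inPart≡∣S∣ balanced v ⟩
    ∣ balanced ∣
      ≡⟨ ∣balanced∣ ⟩
    k + h ∎)
    where
    open ≤-Reasoning
    0<quota : 0 < quota (q v)
    0<quota = m<n⇒0<n (<ᵇ⇒< _ _ (subst T (trans (sym v∈B) (lookup∘tabulate inQuota v)) tt))

  suc-n<∣balanced∣ : suc n < ∣ balanced ∣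
  suc-n<∣balanced∣ =
    ≤-reflexive (sym (trans ∣balanced∣ (trans (+-comm k h) (⌊n/2⌋+⌈n/2⌉≡n (suc (suc n))))))

  sensitivity : IsSensitivity G k
  sensitivity = isSensitivity G (independenceNumber-K zero)
    (balanced , suc-n<∣balanced∣ ,
      ≤-antisym (maxDegIn-lub G balanced k degIn-balanced≤k)
                (⌈suc-n/2⌉≤maxDegIn balanced suc-n<∣balanced∣))
    ⌈suc-n/2⌉≤maxDegIn

sensitivity-K : ∀ n m → IsSensitivity (K (suc n) (suc (suc m))) ⌈ suc (suc n) /2⌉
sensitivity-K = Balanced.sensitivity

sensitivity-K-unique : ∀ n m {c} → IsSensitivity (K (suc n) (suc (suc m))) c → c ≡ ⌈ suc (suc n) /2⌉
sensitivity-K-unique n m σc =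
  sensitivity-unique (K (suc n) (suc (suc m)))
    (Multipartite.independenceNumber-K (suc n) (suc (suc m)) zero) σc (sensitivity-K n m)

fixedParts-sensitive : ∀ m → SensitiveFamily (λ n → K n (suc (suc m)))
fixedParts-sensitive m = maxDeg→∞ , σ→∞
  where
  maxDeg→∞ : Diverges (λ n → maxDeg (K n (suc (suc m))))
  maxDeg→∞ B = suc B , λ { (suc n) (s≤s B≤n) →
    ≤-trans B≤n (≤-trans (n≤1+n n) (≤-trans (m≤m+n (suc n) _) (m*n≤maxDeg-K n (suc m)))) }
  σ→∞ : SensitivityDiverges (λ n → K n (suc (suc m)))
  σ→∞ B = suc (B + B) , λ { (suc n) (s≤s B+B≤n) c σc →
    subst (B ≤_) (sym (sensitivity-K-unique n m σc))
      (m+m≤n⇒m≤⌈n/2⌉ (≤-trans B+B≤n (≤-trans (n≤1+n n) (n≤1+n _)))) }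

fixedPartSize-insensitive : ∀ n → InsensitiveFamily (λ m → K (suc n) m)
fixedPartSize-insensitive n = maxDeg→∞ , σ-bounded
  where
  maxDeg→∞ : Diverges (λ m → maxDeg (K (suc n) m))
  maxDeg→∞ B = suc (suc B) , λ { (suc (suc m)) (s≤s (s≤s B≤m)) →
    ≤-trans B≤m (≤-trans (n≤1+n m) (≤-trans (m≤m*n (suc m) (suc n)) (m*n≤maxDeg-K n (suc m)))) }
  σ-bounded : ¬ SensitivityDiverges (λ m → K (suc n) m)
  σ-bounded σ→∞ with σ→∞ (suc ⌈ suc (suc n) /2⌉)
  ... | N , σ≥ = <-irrefl refl (σ≥ (suc (suc N)) (≤-trans (n≤1+n N) (n≤1+n _)) _ (sensitivity-K n N))

from-1≤ : {P : ℕ → Set} → (∀ n → P (suc n)) → ∀ n → 1 ≤ n → P n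
from-1≤ p (suc n) _ = p n

from-2≤ : {P : ℕ → Set} → (∀ m → P (suc (suc m))) → ∀ m → 2 ≤ m → P m
from-2≤ p (suc (suc m)) _ = p m
from-2≤ p (suc zero) (s≤s ())

corollary3p12 : (∀ n m → 1 ≤ n → 2 ≤ m → IsSensitivity (K n m) ⌈ suc n /2⌉)
    × (∀ m → 2 ≤ m → SensitiveFamily (λ n → K n m))
    × (∀ n → 1 ≤ n →
         InsensitiveFamily (λ m → K n m)
         × (∃ λ c → ∀ m → 2 ≤ m → IsSensitivity (K n m) c))
    × (∀ B → ∃ λ n → 1 ≤ n × (∃ λ c → B ≤ c × (∀ m → 2 ≤ m → IsSensitivity (K n m) c)))
corollary3p12 =
  sensitivity ,
  from-2≤ fixedParts-sensitive ,
  from-1≤ (λ n → fixedPartSize-insensitive n , ⌈ suc (suc n) /2⌉ , constantSensitivity n) ,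
  λ B → suc (B + B) , s≤s z≤n , ⌈ suc (suc (B + B)) /2⌉ ,
        m+m≤n⇒m≤⌈n/2⌉ (≤-trans (n≤1+n _) (n≤1+n _)) , constantSensitivity (B + B)
  where
  sensitivity : ∀ n m → 1 ≤ n → 2 ≤ m → IsSensitivity (K n m) ⌈ suc n /2⌉
  sensitivity (suc n) (suc (suc m)) _ _        = sensitivity-K n m
  sensitivity (suc n) (suc zero)    _ (s≤s ())
  constantSensitivity : ∀ n m → 2 ≤ m → IsSensitivity (K (suc n) m) ⌈ suc (suc n) /2⌉
  constantSensitivity n = from-2≤ (sensitivity-K n)
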